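{- For every meta-formula $\Delta$ and formula $C$ of $\boldsymbol{!}_\mathbf{b}\mathbf{L}^{\mathbf{1}}$: if $\boldsymbol{!}_\mathbf{b}\mathbf{L}^{\mathbf{1}}\vdash \Delta\to C$, then $\boldsymbol{!}\mathbf{L}^{\mathbf{1}}\vdash |\Delta|\to|C|$, where $|\cdot|$ is the bracket-forgetting projection.
   Context: The calculus $\boldsymbol{!}_\mathbf{b}\mathbf{L}^{\mathbf{1}}$: formulae are built from variables $p_1,p_2,\dots$ and the constant $\mathbf{1}$ using binary $\backslash$, $/$, $\cdot$ and unary $\langle\rangle$, $[]^{ -1}$, $!$. Meta-formulae are finite (possibly empty, empty one denoted $\Lambda$) sequences whose elements are formulae or bracketed meta-formulae $[\Pi]$; comma is concatenation; $\Delta(\Gamma)$ denotes $\Delta$ with a designated occurrence of a meta-formula $\Gamma$ (consecutive elements at some bracket depth). Sequents are $\Pi\to A$. Axioms: $A\to A$, $\Lambda\to\mathbf{1}$. Rules (premises $\Rightarrow$ conclusion): $(/\to)$: $\Gamma\to B$, $\Delta(C)\to D$ $\Rightarrow$ $\Delta(C/B,\Gamma)\to D$; $(\to/)$: $\Gamma,B\to C$ $\Rightarrow$ $\Gamma\to C/B$; $(\backslash\to)$: $\Gamma\to A$, $\Delta(C)\to D$ $\Rightarrow$ $\Delta(\Gamma,A\backslash C)\to D$; $(\to\backslash)$: $A,\Gamma\to C$ $\Rightarrow$ $\Gamma\to A\backslash C$; $(\cdot\to)$: $\Delta(A,B)\to D$ $\Rightarrow$ $\Delta(A\cdot B)\to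 D$; $(\to\cdot)$: $\Gamma_1\to A$, $\Gamma_2\to B$ $\Rightarrow$ $\Gamma_1,\Gamma_2\to A\cdot B$; $(\mathbf{1}\to)$: $\Delta(\Lambda)\to A$ $\Rightarrow$ $\Delta(\mathbf{1})\to A$; $(\langle\rangle\to)$: $\Delta([A])\to C$ $\Rightarrow$ $\Delta(\langle\rangle A)\to C$; $(\to\langle\rangle)$: $\Pi\to A$ $\Rightarrow$ $[\Pi]\to\langle\rangle A$; $([]^{ -1}\to)$: $\Delta(A)\to C$ $\Rightarrow$ $\Delta([[]^{ -1}A])\to C$; $(\to[]^{ -1})$: $[\Pi]\to A$ $\Rightarrow$ $\Pi\to[]^{ -1}A$; $(!\to)$: $\Gamma(A)\to B$ $\Rightarrow$ $\Gamma(!A)\to B$; $(\to!)$: $!A_1,\dots,!A_n\to A$ $\Rightarrow$ $!A_1,\dots,!A_n\to!A$; $(\mathrm{contr}_\mathbf{b})$: $\Delta(!A_1,\dots,!A_n,[!A_1,\dots,!A_n,\Gamma])\to B$ $\Rightarrow$ $\Delta(!A_1,\dots,!A_n,\Gamma)\to B$ ($n\ge1$); $(\mathrm{perm}_1)$: $\Delta(!A,\Gamma)\to B$ $\Rightarrow$ $\Delta(\Gamma,!A)\to B$; $(\mathrm{perm}_2)$: $\Delta(\Gamma,!A)\to B$ $\Rightarrow$ $\Delta(!A,\Gamma)\to B$; $(\mathrm{cut})$: $\Pi\to A$, $\Delta(A)\to C$ $\Rightarrow$ $\Delta(\Pi)\to C$. The calculus $\boldsymbol{!}\mathbf{L}^{\mathbf{1}}$: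 formulae are built from variables and $\mathbf{1}$ using $\backslash$, $/$, $\cdot$, $!$ only; antecedents are finite (possibly empty) sequences of formulae; sequents $\Pi\to A$. Axioms $A\to A$, $\Lambda\to\mathbf{1}$. Rules: $(/\to)$: $\Gamma\to B$, $\Delta_1,C,\Delta_2\to D$ $\Rightarrow$ $\Delta_1,C/B,\Gamma,\Delta_2\to D$; $(\to/)$: $\Gamma,B\to C$ $\Rightarrow$ $\Gamma\to C/B$; $(\backslash\to)$: $\Gamma\to A$, $\Delta_1,C,\Delta_2\to D$ $\Rightarrow$ $\Delta_1,\Gamma,A\backslash C,\Delta_2\to D$; $(\to\backslash)$: $A,\Gamma\to C$ $\Rightarrow$ $\Gamma\to A\backslash C$; $(\cdot\to)$: $\Delta_1,A,B,\Delta_2\to D$ $\Rightarrow$ $\Delta_1,A\cdot B,\Delta_2\to D$; $(\to\cdot)$: $\Gamma_1\to A$, $\Gamma_2\to B$ $\Rightarrow$ $\Gamma_1,\Gamma_2\to A\cdot B$; $(\mathbf{1}\to)$: $\Delta_1,\Delta_2\to A$ $\Rightarrow$ $\Delta_1,\mathbf{1},\Delta_2\to A$; $(!\to)$: $\Gamma_1,A,\Gamma_2\to B$ $\Rightarrow$ $\Gamma_1,!A,\Gamma_2\to B$; $(\to!)$: $!A_1,\dots,!A_n\to A$ $\Rightarrow$ $!A_1,\dots,!A_n\to!A$; $(\mathrm{perm}_1)$: $\Delta_1,!A,\Gamma,\Delta_2\to B$ $\Rightarrow$ $\Delta_1,\Gamma,!A,\Delta_2\to B$; $(\mathrm{perm}_2)$: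 $\Delta_1,\Gamma,!A,\Delta_2\to B$ $\Rightarrow$ $\Delta_1,!A,\Gamma,\Delta_2\to B$; $(\mathrm{contr})$: $\Delta_1,!A,!A,\Delta_2\to B$ $\Rightarrow$ $\Delta_1,!A,\Delta_2\to B$; $(\mathrm{cut})$: $\Pi\to A$, $\Delta_1,A,\Delta_2\to C$ $\Rightarrow$ $\Delta_1,\Pi,\Delta_2\to C$. Bracket-forgetting projection: on formulae, $|p|=p$, $|\mathbf{1}|=\mathbf{1}$, $|A\backslash B|=|A|\backslash|B|$, $|B/A|=|B|/|A|$, $|A\cdot B|=|A|\cdot|B|$, $|!A|=!|A|$, $|\langle\rangle A|=|A|$, $|[]^{ -1}A|=|A|$; on meta-formulae it removes all brackets and applies $|\cdot|$ to each formula, yielding a sequence of formulae. -}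

module Defs where

open import Data.Nat using (ℕ)
open import Data.List using (List; []; _∷_; _++_; [_]; map; concatMap)

infixr 6 _⟨\⟩_ _⟨/⟩_ _⟨·⟩_

data Fm : Set where
  var   : ℕ → Fm
  𝟏     : Fm
  _⟨\⟩_ : Fm → Fm → Fm
  _⟨/⟩_ : Fm → Fm → Fm
  _⟨·⟩_ : Fm → Fm → Fm
  ⟨⟩_   : Fm → Fm
  []⁻¹_ : Fm → Fm
  !_    : Fm → Fm

data Elem : Set where
  fm : Fm → Elem
  br : List Elem → Elem

Meta : Set
Meta = List Elem

fms : List Fm → Meta
fms = map fm

bangs : List Fm → Meta
bangs As = map (λ A → fm (! A)) As

-- contexts Δ( _ ): a meta-formula with a designated hole, at some bracket depth
data Ctx : Set where
  top  : Meta → Meta → Ctx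
  deep : Meta → Ctx → Meta → Ctx

_⟦_⟧ : Ctx → Meta → Meta
top L R ⟦ Γ ⟧ = L ++ Γ ++ R
deep L Δ R ⟦ Γ ⟧ = L ++ br (Δ ⟦ Γ ⟧) ∷ R

-- nonempty list (side condition n ≥ 1 of contr_b)
data NonEmpty {A : Set} : List A → Set where
  nonempty : ∀ {x xs} → NonEmpty (x ∷ xs)

infix 4 _⇒b_

data _⇒b_ : Meta → Fm → Set where
  ax     : ∀ {A} → [ fm A ] ⇒b A
  ax𝟏    : [] ⇒b 𝟏
  /L     : ∀ {Γ Δ B C D} → Γ ⇒b B → Δ ⟦ [ fm C ] ⟧ ⇒b D →
           Δ ⟦ fm (C ⟨/⟩ B) ∷ Γ ⟧ ⇒b D
  /R     : ∀ {Γ B C} → Γ ++ [ fm B ] ⇒b C → Γ ⇒b C ⟨/⟩ B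
  bsL     : ∀ {Γ Δ A C D} → Γ ⇒b A → Δ ⟦ [ fm C ] ⟧ ⇒b D →
           Δ ⟦ Γ ++ [ fm (A ⟨\⟩ C) ] ⟧ ⇒b D
  bsR     : ∀ {Γ A C} → fm A ∷ Γ ⇒b C → Γ ⇒b A ⟨\⟩ C
  ·L     : ∀ {Δ A B D} → Δ ⟦ fm A ∷ fm B ∷ [] ⟧ ⇒b D → Δ ⟦ [ fm (A ⟨·⟩ B) ] ⟧ ⇒b D
  ·R     : ∀ {Γ₁ Γ₂ A B} → Γ₁ ⇒b A → Γ₂ ⇒b B → Γ₁ ++ Γ₂ ⇒b A ⟨·⟩ B
  𝟏L     : ∀ {Δ A} → Δ ⟦ [] ⟧ ⇒b A → Δ ⟦ [ fm 𝟏 ] ⟧ ⇒b A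
  ⟨⟩L    : ∀ {Δ A C} → Δ ⟦ [ br [ fm A ] ] ⟧ ⇒b C → Δ ⟦ [ fm (⟨⟩ A) ] ⟧ ⇒b C
  ⟨⟩R    : ∀ {Π A} → Π ⇒b A → [ br Π ] ⇒b ⟨⟩ A
  []⁻¹L  : ∀ {Δ A C} → Δ ⟦ [ fm A ] ⟧ ⇒b C → Δ ⟦ [ br [ fm ([]⁻¹ A) ] ] ⟧ ⇒b C
  []⁻¹R  : ∀ {Π A} → [ br Π ] ⇒b A → Π ⇒b []⁻¹ A
  !L     : ∀ {Δ A B} → Δ ⟦ [ fm A ] ⟧ ⇒b B → Δ ⟦ [ fm (! A) ] ⟧ ⇒b B
  !R     : ∀ {As A} → bangs As ⇒b A → bangs As ⇒b ! A
  contrb : ∀ {Δ As Γ B} → NonEmpty As → Δ ⟦ bangs As ++ br (bangs As ++ Γ) ∷ [] ⟧ ⇒b B →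
           Δ ⟦ bangs As ++ Γ ⟧ ⇒b B
  perm₁  : ∀ {Δ A Γ B} → Δ ⟦ fm (! A) ∷ Γ ⟧ ⇒b B → Δ ⟦ Γ ++ [ fm (! A) ] ⟧ ⇒b B
  perm₂  : ∀ {Δ A Γ B} → Δ ⟦ Γ ++ [ fm (! A) ] ⟧ ⇒b B → Δ ⟦ fm (! A) ∷ Γ ⟧ ⇒b B
  cut    : ∀ {Π Δ A C} → Π ⇒b A → Δ ⟦ [ fm A ] ⟧ ⇒b C → Δ ⟦ Π ⟧ ⇒b C

data LFm : Set where
  var   : ℕ → LFm
  𝟏     : LFm
  _⟨\⟩_ : LFm → LFm → LFm
  _⟨/⟩_ : LFm → LFm → LFm
  _⟨·⟩_ : LFm → LFm → LFm
  !_    : LFm → LFm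

lbangs : List LFm → List LFm
lbangs As = map !_ As

infix 4 _⇒_

data _⇒_ : List LFm → LFm → Set where
  ax     : ∀ {A} → [ A ] ⇒ A
  ax𝟏    : [] ⇒ 𝟏
  /L     : ∀ {Γ Δ₁ Δ₂ B C D} → Γ ⇒ B → Δ₁ ++ C ∷ Δ₂ ⇒ D →
           Δ₁ ++ (C ⟨/⟩ B) ∷ Γ ++ Δ₂ ⇒ D
  /R     : ∀ {Γ B C} → Γ ++ [ B ] ⇒ C → Γ ⇒ C ⟨/⟩ B
  bsL     : ∀ {Γ Δ₁ Δ₂ A C D} → Γ ⇒ A → Δ₁ ++ C ∷ Δ₂ ⇒ D →
           Δ₁ ++ Γ ++ (A ⟨\⟩ C) ∷ Δ₂ ⇒ D
  bsR     : ∀ {Γ A C} → A ∷ Γ ⇒ C → Γ ⇒ A ⟨\⟩ C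
  ·L     : ∀ {Δ₁ Δ₂ A B D} → Δ₁ ++ A ∷ B ∷ Δ₂ ⇒ D → Δ₁ ++ (A ⟨·⟩ B) ∷ Δ₂ ⇒ D
  ·R     : ∀ {Γ₁ Γ₂ A B} → Γ₁ ⇒ A → Γ₂ ⇒ B → Γ₁ ++ Γ₂ ⇒ A ⟨·⟩ B
  𝟏L     : ∀ {Δ₁ Δ₂ A} → Δ₁ ++ Δ₂ ⇒ A → Δ₁ ++ 𝟏 ∷ Δ₂ ⇒ A
  !L     : ∀ {Γ₁ Γ₂ A B} → Γ₁ ++ A ∷ Γ₂ ⇒ B → Γ₁ ++ (! A) ∷ Γ₂ ⇒ B
  !R     : ∀ {As A} → lbangs As ⇒ A → lbangs As ⇒ ! A
  perm₁  : ∀ {Δ₁ Δ₂ Γ A B} → Δ₁ ++ (! A) ∷ Γ ++ Δ₂ ⇒ B → Δ₁ ++ Γ ++ (! A) ∷ Δ₂ ⇒ B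
  perm₂  : ∀ {Δ₁ Δ₂ Γ A B} → Δ₁ ++ Γ ++ (! A) ∷ Δ₂ ⇒ B → Δ₁ ++ (! A) ∷ Γ ++ Δ₂ ⇒ B
  contr  : ∀ {Δ₁ Δ₂ A B} → Δ₁ ++ (! A) ∷ (! A) ∷ Δ₂ ⇒ B → Δ₁ ++ (! A) ∷ Δ₂ ⇒ B
  cut    : ∀ {Π Δ₁ Δ₂ A C} → Π ⇒ A → Δ₁ ++ A ∷ Δ₂ ⇒ C → Δ₁ ++ Π ++ Δ₂ ⇒ C

∣_∣ : Fm → LFm
∣ var i ∣ = var i
∣ 𝟏 ∣ = 𝟏
∣ A ⟨\⟩ B ∣ = ∣ A ∣ ⟨\⟩ ∣ B ∣
∣ B ⟨/⟩ A ∣ = ∣ B ∣ ⟨/⟩ ∣ A ∣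
∣ A ⟨·⟩ B ∣ = ∣ A ∣ ⟨·⟩ ∣ B ∣
∣ ⟨⟩ A ∣ = ∣ A ∣
∣ []⁻¹ A ∣ = ∣ A ∣
∣ ! A ∣ = ! ∣ A ∣

mutual
  ∣_∣ᴹ : Meta → List LFm
  ∣ [] ∣ᴹ = []
  ∣ e ∷ Π ∣ᴹ = ∣ e ∣ᴱ ++ ∣ Π ∣ᴹ

  ∣_∣ᴱ : Elem → List LFm
  ∣ fm A ∣ᴱ = [ ∣ A ∣ ]
  ∣ br Π ∣ᴱ = ∣ Π ∣ᴹ

module Submission where

open import Defs
open import Data.List using (List; []; _∷_; _++_; [_]; map)
open import Data.List.Properties using (++-assoc; ++-identityʳ)
open import Function using (id)
open import Relation.Binary.PropositionalEquality
  using (_≡_; refl; sym; cong; subst; module ≡-Reasoning)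

-- Forgetting brackets turns each rule acting inside
-- a context Δ( _ ) into the same rule of !L¹ between the projections of the
-- parts of Δ left and right of the hole, and the bracket rules for ⟨⟩ and []⁻¹
-- into identities. Only contr_b has no direct counterpart: it projects to a
-- contraction of the whole block !A₁,…,!Aₙ, derivable in !L¹ by moving each
-- second copy of !Aᵢ next to the first with perm₂ and contracting.

cast : ∀ {Γ Γ′ C} → Γ ≡ Γ′ → Γ ⇒ C → Γ′ ⇒ C
cast = subst (_⇒ _)

contr-bangs : ∀ As L R {B} → L ++ lbangs As ++ lbangs As ++ R ⇒ B → L ++ lbangs As ++ R ⇒ B
contr-bangs []       L R d = d
contr-bangs (A ∷ As) L R {B} d =
  cast (++-assoc L [ ! A ] _) (contr-bangs As (L ++ [ ! A ]) R (cast (sym (++-assoc L [ ! A ] _)) contracted))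
  where
  adjacent : L ++ ! A ∷ ! A ∷ lbangs As ++ lbangs As ++ R ⇒ B
  adjacent = cast (++-assoc L [ ! A ] _)
               (perm₂ {Δ₁ = L ++ [ ! A ]} {Γ = lbangs As} (cast (sym (++-assoc L [ ! A ] _)) d))

  contracted : L ++ ! A ∷ lbangs As ++ lbangs As ++ R ⇒ B
  contracted = contr {Δ₁ = L} adjacent

∣∣ᴹ-++ : ∀ Γ Π → ∣ Γ ++ Π ∣ᴹ ≡ ∣ Γ ∣ᴹ ++ ∣ Π ∣ᴹ
∣∣ᴹ-++ []      Π = refl
∣∣ᴹ-++ (e ∷ Γ) Π = begin
  ∣ e ∣ᴱ ++ ∣ Γ ++ Π ∣ᴹ          ≡⟨ cong (∣ e ∣ᴱ ++_) (∣∣ᴹ-++ Γ Π) ⟩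
  ∣ e ∣ᴱ ++ ∣ Γ ∣ᴹ ++ ∣ Π ∣ᴹ     ≡⟨ ++-assoc ∣ e ∣ᴱ ∣ Γ ∣ᴹ ∣ Π ∣ᴹ ⟨
  (∣ e ∣ᴱ ++ ∣ Γ ∣ᴹ) ++ ∣ Π ∣ᴹ   ∎
  where open ≡-Reasoning

∣∣ᴹ-++-++ : ∀ Γ Π R → ∣ Γ ++ Π ∣ᴹ ++ R ≡ ∣ Γ ∣ᴹ ++ ∣ Π ∣ᴹ ++ R
∣∣ᴹ-++-++ Γ Π R = begin
  ∣ Γ ++ Π ∣ᴹ ++ R              ≡⟨ cong (_++ R) (∣∣ᴹ-++ Γ Π) ⟩
  (∣ Γ ∣ᴹ ++ ∣ Π ∣ᴹ) ++ R       ≡⟨ ++-assoc ∣ Γ ∣ᴹ ∣ Π ∣ᴹ R ⟩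
  ∣ Γ ∣ᴹ ++ ∣ Π ∣ᴹ ++ R         ∎
  where open ≡-Reasoning

∣∣ᴹ-bangs : ∀ As → ∣ bangs As ∣ᴹ ≡ lbangs (map ∣_∣ As)
∣∣ᴹ-bangs []       = refl
∣∣ᴹ-bangs (A ∷ As) = cong (! ∣ A ∣ ∷_) (∣∣ᴹ-bangs As)

∣_∣ˡ ∣_∣ʳ : Ctx → List LFm
∣ top L R ∣ˡ    = ∣ L ∣ᴹ
∣ deep L Δ R ∣ˡ = ∣ L ∣ᴹ ++ ∣ Δ ∣ˡ
∣ top L R ∣ʳ    = ∣ R ∣ᴹ
∣ deep L Δ R ∣ʳ = ∣ Δ ∣ʳ ++ ∣ R ∣ᴹ

∣∣ᴹ-⟦⟧ : ∀ Δ Γ → ∣ Δ ⟦ Γ ⟧ ∣ᴹ ≡ ∣ Δ ∣ˡ ++ ∣ Γ ∣ᴹ ++ ∣ Δ ∣ʳ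
∣∣ᴹ-⟦⟧ (top L R) Γ = begin
  ∣ L ++ Γ ++ R ∣ᴹ              ≡⟨ ∣∣ᴹ-++ L (Γ ++ R) ⟩
  ∣ L ∣ᴹ ++ ∣ Γ ++ R ∣ᴹ         ≡⟨ cong (∣ L ∣ᴹ ++_) (∣∣ᴹ-++ Γ R) ⟩
  ∣ L ∣ᴹ ++ ∣ Γ ∣ᴹ ++ ∣ R ∣ᴹ    ∎
  where open ≡-Reasoning
∣∣ᴹ-⟦⟧ (deep L Δ R) Γ = begin
  ∣ L ++ br (Δ ⟦ Γ ⟧) ∷ R ∣ᴹ                      ≡⟨ ∣∣ᴹ-++ L _ ⟩
  ∣ L ∣ᴹ ++ ∣ Δ ⟦ Γ ⟧ ∣ᴹ ++ ∣ R ∣ᴹ                ≡⟨ cong (λ X → ∣ L ∣ᴹ ++ X ++ ∣ R ∣ᴹ) (∣∣ᴹ-⟦⟧ Δ Γ) ⟩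
  ∣ L ∣ᴹ ++ (l ++ g ++ r) ++ ∣ R ∣ᴹ              ≡⟨ cong (∣ L ∣ᴹ ++_) (++-assoc l (g ++ r) ∣ R ∣ᴹ) ⟩
  ∣ L ∣ᴹ ++ l ++ (g ++ r) ++ ∣ R ∣ᴹ              ≡⟨ ++-assoc ∣ L ∣ᴹ l _ ⟨
  (∣ L ∣ᴹ ++ l) ++ (g ++ r) ++ ∣ R ∣ᴹ            ≡⟨ cong ((∣ L ∣ᴹ ++ l) ++_) (++-assoc g r ∣ R ∣ᴹ) ⟩
  (∣ L ∣ᴹ ++ l) ++ g ++ r ++ ∣ R ∣ᴹ              ∎
  where
  open ≡-Reasoning
  l = ∣ Δ ∣ˡ
  g = ∣ Γ ∣ᴹ
  r = ∣ Δ ∣ʳ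

inContext : ∀ Δ {Γ Γ′ D} →
            (∀ {L R} → L ++ ∣ Γ ∣ᴹ ++ R ⇒ D → L ++ ∣ Γ′ ∣ᴹ ++ R ⇒ D) →
            ∣ Δ ⟦ Γ ⟧ ∣ᴹ ⇒ D → ∣ Δ ⟦ Γ′ ⟧ ∣ᴹ ⇒ D
inContext Δ {Γ} {Γ′} step d = cast (sym (∣∣ᴹ-⟦⟧ Δ Γ′)) (step {∣ Δ ∣ˡ} {∣ Δ ∣ʳ} (cast (∣∣ᴹ-⟦⟧ Δ Γ) d))

contrb-forgotten : ∀ As Γ L R {D} →
                   L ++ ∣ bangs As ++ [ br (bangs As ++ Γ) ] ∣ᴹ ++ R ⇒ D →
                   L ++ ∣ bangs As ++ Γ ∣ᴹ ++ R ⇒ D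
contrb-forgotten As Γ L R e =
  cast (cong (L ++_) (sym (∣∣ᴹ-++-++ (bangs As) Γ R)))
    (cast (cong (λ X → L ++ X ++ ∣ Γ ∣ᴹ ++ R) (sym (∣∣ᴹ-bangs As)))
      (contr-bangs (map ∣_∣ As) L (∣ Γ ∣ᴹ ++ R) (cast (cong (L ++_) doubled) e)))
  where
  bs = lbangs (map ∣_∣ As)

  doubled : ∣ bangs As ++ [ br (bangs As ++ Γ) ] ∣ᴹ ++ R ≡ bs ++ bs ++ ∣ Γ ∣ᴹ ++ R
  doubled = begin
    ∣ bangs As ++ [ br (bangs As ++ Γ) ] ∣ᴹ ++ R      ≡⟨ ∣∣ᴹ-++-++ (bangs As) _ R ⟩
    ∣ bangs As ∣ᴹ ++ (∣ bangs As ++ Γ ∣ᴹ ++ []) ++ R   ≡⟨ cong (λ X → ∣ bangs As ∣ᴹ ++ X ++ R) (++-identityʳ _) ⟩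
    ∣ bangs As ∣ᴹ ++ ∣ bangs As ++ Γ ∣ᴹ ++ R          ≡⟨ cong (∣ bangs As ∣ᴹ ++_) (∣∣ᴹ-++-++ (bangs As) Γ R) ⟩
    ∣ bangs As ∣ᴹ ++ ∣ bangs As ∣ᴹ ++ ∣ Γ ∣ᴹ ++ R     ≡⟨ cong (λ X → X ++ X ++ ∣ Γ ∣ᴹ ++ R) (∣∣ᴹ-bangs As) ⟩
    bs ++ bs ++ ∣ Γ ∣ᴹ ++ R                          ∎
    where open ≡-Reasoning

forget : ∀ {Δ C} → Δ ⇒b C → ∣ Δ ∣ᴹ ⇒ ∣ C ∣
forget ax                        = ax
forget ax𝟏                       = ax𝟏
forget (/L {Δ = Δ} d e)          = inContext Δ (/L (forget d)) (forget e)
forget (/R {Γ} d)                = /R (cast (∣∣ᴹ-++ Γ _) (forget d))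
forget (bsL {Γ} {Δ} d e)         =
  inContext Δ (λ {L} {R} e′ → cast (cong (L ++_) (sym (∣∣ᴹ-++-++ Γ _ R))) (bsL (forget d) e′)) (forget e)
forget (bsR d)                   = bsR (forget d)
forget (·L {Δ} d)                = inContext Δ ·L (forget d)
forget (·R {Γ₁} {Γ₂} d e)        = cast (sym (∣∣ᴹ-++ Γ₁ Γ₂)) (·R (forget d) (forget e))
forget (𝟏L {Δ} d)                = inContext Δ 𝟏L (forget d)
forget (⟨⟩L {Δ} d)               = inContext Δ id (forget d)
forget (⟨⟩R {Π} d)               = cast (sym (++-identityʳ ∣ Π ∣ᴹ)) (forget d)
forget ([]⁻¹L {Δ} d)             = inContext Δ id (forget d)
forget ([]⁻¹R {Π} d)             = cast (++-identityʳ ∣ Π ∣ᴹ) (forget d)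
forget (!L {Δ} d)                = inContext Δ !L (forget d)
forget (!R {As} d)               = cast (sym (∣∣ᴹ-bangs As)) (!R (cast (∣∣ᴹ-bangs As) (forget d)))
forget (contrb {Δ} {As} {Γ} _ d) = inContext Δ (λ {L} {R} → contrb-forgotten As Γ L R) (forget d)
forget (perm₁ {Δ} {A} {Γ} d)     =
  inContext Δ (λ {L} {R} e → cast (cong (L ++_) (sym (∣∣ᴹ-++-++ Γ [ fm (! A) ] R))) (perm₁ e)) (forget d)
forget (perm₂ {Δ} {A} {Γ} d)     =
  inContext Δ (λ {L} {R} e → perm₂ (cast (cong (L ++_) (∣∣ᴹ-++-++ Γ [ fm (! A) ] R)) e)) (forget d)
forget (cut {Π} {Δ} d e)         = inContext Δ (cut (forget d)) (forget e)

lemma2 : (Δ : Meta) (C : Fm) → Δ ⇒b C → ∣ Δ ∣ᴹ ⇒ ∣ C ∣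
lemma2 Δ C = forget
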